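{- Let $H$ be an $n$-vertex graph with at least one edge, with average degree $d$ and maximum degree $\Delta$. Then every lexicographic coloring of $H$ uses at least $nd/(2\Delta)$ distinct colors.
   Context: A lexicographic coloring of $H$ is an edge-coloring of $H$ for which there is an ordering $v_1,\dots,v_n$ of $V(H)$ such that for each $i$, all edges $v_iv_j\in E(H)$ with $j>i$ receive the same color $c_i$, and these colors are distinct for different vertices $v_i$ (among vertices having at least one such edge). -}

module Defs where

open import Data.Nat using (ℕ; _⊔_; _<_; _+_; _*_; _≤_)
open import Data.Nat.Properties using () renaming (_≟_ to _≟ℕ_)
open import Data.Bool using (Bool; true; false; if_then_else_)
open import Data.Fin using (Fin; toℕ)
open import Data.Fin.Permutation using (Permutation′; _⟨$⟩ʳ_)
open import Data.List using (List; []; _∷_; map; concatMap; filter; length; foldr; deduplicate; allFin)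
open import Data.Nat.ListAction using (sum)
open import Data.Product using (Σ; _×_; _,_; ∃; ∃-syntax)
open import Relation.Binary.PropositionalEquality using (_≡_; _≢_)
open import Relation.Nullary using (¬_)
open import Data.Bool using (T)
open import Relation.Nullary.Decidable using (T?)

record Graph (n : ℕ) : Set where
  field
    adj   : Fin n → Fin n → Bool
    sym   : ∀ u v → adj u v ≡ adj v u
    irrefl : ∀ u → adj u u ≡ false
open Graph public

Adj : ∀ {n} → Graph n → Fin n → Fin n → Set
Adj G u v = adj G u v ≡ true

deg : ∀ {n} → Graph n → Fin n → ℕ
deg G u = length (filter (λ v → T? (adj G u v)) (allFin _))

-- sum of all degrees (= n · d, where d is the average degree)
degSum : ∀ {n} → Graph n → ℕ
degSum G = sum (map (deg G) (allFin _))

-- maximum degree Δ (0 for the empty vertex set)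
maxDeg : ∀ {n} → Graph n → ℕ
maxDeg G = foldr _⊔_ 0 (map (deg G) (allFin _))

record EdgeColoring {n} (G : Graph n) : Set where
  field
    col  : Fin n → Fin n → ℕ
    symm : ∀ u v → Adj G u v → col u v ≡ col v u
open EdgeColoring public

edgeColours : ∀ {n} {G : Graph n} → EdgeColoring G → List ℕ
edgeColours {n} {G} c =
  concatMap (λ u → map (col c u)
    (filter (λ v → T? (adj G u v)) (filter (λ v → toℕ u Data.Nat.<? toℕ v) (allFin n))))
    (allFin n)
  where import Data.Nat

numColours : ∀ {n} {G : Graph n} → EdgeColoring G → ℕ
numColours c = length (deduplicate _≟ℕ_ (edgeColours c))

-- Lexicographic colouring: an ordering v_i = σ i of the vertices and a colour
-- c_i for each position i such that every edge v_i v_j with j > i gets colour c_i,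
-- and c_i ≠ c_{i'} for distinct i, i' that both have a forward edge.
HasForwardEdge : ∀ {n} (G : Graph n) (σ : Permutation′ n) → Fin n → Set
HasForwardEdge {n} G σ i = ∃[ j ] (toℕ i < toℕ j × Adj G (σ ⟨$⟩ʳ i) (σ ⟨$⟩ʳ j))

IsLexicographic : ∀ {n} {G : Graph n} → EdgeColoring G → Set
IsLexicographic {n} {G} c =
  Σ (Permutation′ n) λ σ → Σ (Fin n → ℕ) λ cc →
      (∀ i j → toℕ i < toℕ j → Adj G (σ ⟨$⟩ʳ i) (σ ⟨$⟩ʳ j) →
               col c (σ ⟨$⟩ʳ i) (σ ⟨$⟩ʳ j) ≡ cc i)
    × (∀ i i' → i ≢ i' → HasForwardEdge G σ i → HasForwardEdge G σ i' → cc i ≢ cc i')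

module Submission where

-- In a lexicographic colouring along v₁, …, vₙ, an edge vᵢvⱼ with i < j has
-- colour cᵢ, and vertices with a forward edge have pairwise distinct colours;
-- so every edge of colour cᵢ contains vᵢ, i.e. every colour class is a star.
-- A star has at most Δ edges, hence n·d = 2|E| ≤ 2Δ · (number of colours).

open import Defs

open import Data.Bool using (Bool; true; false; _∧_; if_then_else_; T)
open import Data.Empty using (⊥-elim)
open import Data.Fin using (Fin; zero; suc; toℕ)
open import Data.Fin.Permutation using (_⟨$⟩ʳ_; inverseʳ)
open import Data.Fin.Properties using (toℕ-injective) renaming (_≟_ to _≟ᶠ_)
open import Data.List using (List; _∷_; lookup; tabulate; filter; length; foldr; deduplicate)
open import Data.List.Membership.Propositional using (_∈_; lose)
open import Data.List.Membership.Propositional.Properties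
  using (∈-allFin; ∈-concatMap⁺; ∈-deduplicate⁺; ∈-filter⁺; ∈-map⁺)
open import Data.List.Properties using (map-tabulate)
open import Data.List.Relation.Unary.Any using (here; there; index)
open import Data.List.Relation.Unary.Any.Properties using (lookup-index)
open import Data.Nat using (ℕ; zero; suc; _+_; _*_; _⊔_; _≤_; _<_; _<?_; _≟_; z≤n)
import Data.Nat.ListAction as List
open import Data.Nat.Properties
  using (+-0-commutativeMonoid; +-identityʳ; +-mono-≤; *-monoʳ-≤; *-comm; ≤-refl; ≤-trans; ≤-reflexive;
         m≤m+n; m≤n+m; m≤m⊔n; m≤n⊔m; <-cmp; module ≤-Reasoning)
open import Data.Product using (∃; ∃-syntax; _×_; _,_)
open import Data.Sum using (_⊎_; inj₁; inj₂)
open import Function using (_∘_; id)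
open import Relation.Binary.Definitions using (tri<; tri≈; tri>)
open import Relation.Binary.PropositionalEquality as ≡ using (_≡_; _≢_; refl; cong; cong₂; subst; subst₂)
open import Relation.Nullary using (does; yes; no)
open import Relation.Nullary.Decidable using (T?; dec-true; dec-false)
open import Algebra.Properties.CommutativeMonoid.Sum +-0-commutativeMonoid
  using (sum; ∑-distrib-+; ∑-comm; sum-cong-≗; sum-replicate-zero)

[_] : Bool → ℕ
[ true ]  = 1
[ false ] = 0

[]≤1 : ∀ b → [ b ] ≤ 1
[]≤1 true  = ≤-refl
[]≤1 false = z≤n

∑-mono-≤ : ∀ {n} {f g : Fin n → ℕ} → (∀ i → f i ≤ g i) → sum f ≤ sum g
∑-mono-≤ {zero}  f≤g = z≤n
∑-mono-≤ {suc n} f≤g = +-mono-≤ (f≤g zero) (∑-mono-≤ (f≤g ∘ suc))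

∑-≤-* : ∀ {n c} {f : Fin n → ℕ} → (∀ i → f i ≤ c) → sum f ≤ n * c
∑-≤-* {zero}  f≤c = z≤n
∑-≤-* {suc n} f≤c = +-mono-≤ (f≤c zero) (∑-≤-* (f≤c ∘ suc))

term≤∑ : ∀ {n} (f : Fin n → ℕ) i → f i ≤ sum f
term≤∑ f zero    = m≤m+n _ _
term≤∑ f (suc i) = ≤-trans (term≤∑ (f ∘ suc) i) (m≤n+m _ _)

∑≢0⇒∃≢0 : ∀ {n} (f : Fin n → ℕ) → sum f ≢ 0 → ∃[ i ] f i ≢ 0
∑≢0⇒∃≢0 {zero}  f ∑f≢0 = ⊥-elim (∑f≢0 refl)
∑≢0⇒∃≢0 {suc n} f ∑f≢0 with f zero ≟ 0
... | no f₀≢0  = zero , f₀≢0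
... | yes f₀≡0 with ∑≢0⇒∃≢0 (f ∘ suc) (∑f≢0 ∘ cong₂ _+_ f₀≡0)
...   | i , fᵢ≢0 = suc i , fᵢ≢0

∑-select : ∀ {n} (f : Fin n → ℕ) w → sum (λ i → if does (i ≟ᶠ w) then f i else 0) ≡ f w
∑-select {suc n} f zero    = ≡.trans (cong (f zero +_) (sum-replicate-zero n)) (+-identityʳ _)
∑-select {suc n} f (suc w) = ∑-select (f ∘ suc) w

sum-tabulate : ∀ {n} (f : Fin n → ℕ) → List.sum (tabulate f) ≡ sum f
sum-tabulate {zero}  f = refl
sum-tabulate {suc n} f = cong (f zero +_) (sum-tabulate (f ∘ suc))

length-filter-tabulate : ∀ {A : Set} {n} (p : A → Bool) (f : Fin n → A) →
  length (filter (T? ∘ p) (tabulate f)) ≡ sum ([_] ∘ p ∘ f)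
length-filter-tabulate {n = zero}  p f = refl
length-filter-tabulate {n = suc n} p f with p (f zero)
... | true  = cong suc (length-filter-tabulate p (f ∘ suc))
... | false = length-filter-tabulate p (f ∘ suc)

∈⇒≤foldr-⊔ : ∀ {x xs} → x ∈ xs → x ≤ foldr _⊔_ 0 xs
∈⇒≤foldr-⊔ (here refl) = m≤m⊔n _ _
∈⇒≤foldr-⊔ {xs = y ∷ _} (there x∈xs) = ≤-trans (∈⇒≤foldr-⊔ x∈xs) (m≤n⊔m y _)

module _ {n} (G : Graph n) where

  Adj⇒≢ : ∀ {u v} → Adj G u v → u ≢ v
  Adj⇒≢ {u} uu refl with ≡.trans (≡.sym uu) (irrefl G u)
  ... | ()

  Adj-sym : ∀ {u v} → Adj G u v → Adj G v u
  Adj-sym {u} {v} uv = ≡.trans (sym G v u) uv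

  deg≡∑adj : ∀ u → deg G u ≡ sum (λ v → [ adj G u v ])
  deg≡∑adj u = length-filter-tabulate (adj G u) id

  degSum≡∑deg : degSum G ≡ sum (deg G)
  degSum≡∑deg = ≡.trans (cong List.sum (map-tabulate id (deg G))) (sum-tabulate (deg G))

  deg≤maxDeg : ∀ u → deg G u ≤ maxDeg G
  deg≤maxDeg u = ∈⇒≤foldr-⊔ (∈-map⁺ (deg G) (∈-allFin u))

module _ {n} {G : Graph n} (c : EdgeColoring G) where

  hasColour : ℕ → Fin n → Fin n → Bool
  hasColour x a b = adj G a b ∧ does (col c a b ≟ x)

  -- Sums over ordered pairs, so every edge of colour x is counted twice.
  colourClassSize : ℕ → ℕ
  colourClassSize x = sum λ a → sum λ b → [ hasColour x a b ]

  hasColour⇒ : ∀ {x a b} → [ hasColour x a b ] ≢ 0 → Adj G a b × col c a b ≡ x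
  hasColour⇒ {x} {a} {b} h with adj G a b | col c a b ≟ x
  ... | true  | yes colour≡ = refl , colour≡
  ... | true  | no colour≢  = ⊥-elim (h (cong [_] (dec-false (col c a b ≟ x) colour≢)))
  ... | false | _           = ⊥-elim (h refl)

  IsStar : ℕ → Fin n → Set
  IsStar x w = ∀ {a b} → Adj G a b → col c a b ≡ x → a ≡ w ⊎ b ≡ w

  star⇒colourClassSize≤2deg : ∀ {x w} → IsStar x w → colourClassSize x ≤ 2 * deg G w
  star⇒colourClassSize≤2deg {x} {w} star = begin
    colourClassSize x                                 ≤⟨ ∑-mono-≤ (λ a → ∑-mono-≤ (hasColour≤incident a)) ⟩
    sum (λ a → sum λ b → leaving a b + entering a b)  ≡⟨ sum-cong-≗ (λ a → ∑-distrib-+ (leaving a) (entering a)) ⟩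
    sum (λ a → sum (leaving a) + sum (entering a))    ≡⟨ ∑-distrib-+ (sum ∘ leaving) (sum ∘ entering) ⟩
    sum (sum ∘ leaving) + sum (sum ∘ entering)        ≡⟨ cong₂ _+_ ∑leaving≡deg ∑entering≡deg ⟩
    deg G w + deg G w                                 ≡⟨ cong (deg G w +_) (+-identityʳ _) ⟨
    2 * deg G w                                       ∎
    where
    open ≤-Reasoning

    leaving entering : Fin n → Fin n → ℕ
    leaving  a b = if does (a ≟ᶠ w) then [ adj G a b ] else 0
    entering a b = if does (b ≟ᶠ w) then [ adj G a b ] else 0

    incident : ∀ {a b} → Adj G a b → a ≡ w ⊎ b ≡ w → 1 ≤ leaving a b + entering a b
    incident {a}     ab (inj₁ refl) rewrite dec-true (a ≟ᶠ a) refl | ab = m≤m+n 1 _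
    incident {b = b} ab (inj₂ refl) rewrite dec-true (b ≟ᶠ b) refl | ab = m≤n+m 1 _

    hasColour≤incident : ∀ a b → [ hasColour x a b ] ≤ leaving a b + entering a b
    hasColour≤incident a b with [ hasColour x a b ] ≟ 0
    ... | yes ≡0 = ≤-trans (≤-reflexive ≡0) z≤n
    ... | no ≢0 with hasColour⇒ ≢0
    ...   | ab , colour≡ = ≤-trans ([]≤1 _) (incident ab (star ab colour≡))

    ∑leaving≡deg : sum (sum ∘ leaving) ≡ deg G w
    ∑leaving≡deg = ≡.trans (∑-comm leaving)
      (≡.trans (sum-cong-≗ (λ b → ∑-select (λ a → [ adj G a b ]) w)) (≡.sym (deg≡∑adj G w)))

    ∑entering≡deg : sum (sum ∘ entering) ≡ deg G w
    ∑entering≡deg = ≡.trans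
      (sum-cong-≗ (λ a → ≡.trans (∑-select (λ b → [ adj G a b ]) w) (cong [_] (sym G a w))))
      (≡.sym (deg≡∑adj G w))

  colourClassSize≤2maxDeg : (∀ {a b} → Adj G a b → ∃[ w ] IsStar (col c a b) w) →
    ∀ x → colourClassSize x ≤ 2 * maxDeg G
  colourClassSize≤2maxDeg stars x with colourClassSize x ≟ 0
  ... | yes size≡0 = ≤-trans (≤-reflexive size≡0) z≤n
  ... | no size≢0 with ∑≢0⇒∃≢0 (λ a → sum λ b → [ hasColour x a b ]) size≢0
  ...   | a , row≢0 with ∑≢0⇒∃≢0 (λ b → [ hasColour x a b ]) row≢0
  ...     | b , entry≢0 with hasColour⇒ {x} {a} {b} entry≢0
  ...       | ab , refl with stars ab
  ...         | w , star = ≤-trans (star⇒colourClassSize≤2deg star) (*-monoʳ-≤ 2 (deg≤maxDeg G w))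

  colourList : List ℕ
  colourList = deduplicate _≟_ (edgeColours c)

  colours : Fin (numColours c) → ℕ
  colours = lookup colourList

  col∈edgeColours : ∀ {u v} → toℕ u < toℕ v → Adj G u v → col c u v ∈ edgeColours c
  col∈edgeColours {u} {v} u<v uv = ∈-concatMap⁺ _ (lose (∈-allFin u)
    (∈-map⁺ (col c u) (∈-filter⁺ (T? ∘ adj G u) (∈-filter⁺ (λ v → toℕ u <? toℕ v) (∈-allFin v) u<v)
                                 (subst T (≡.sym uv) _))))

  col∈colourList : ∀ {u v} → Adj G u v → col c u v ∈ colourList
  col∈colourList {u} {v} uv with <-cmp (toℕ u) (toℕ v)
  ... | tri< u<v _ _ = ∈-deduplicate⁺ _≟_ (col∈edgeColours u<v uv)
  ... | tri≈ _ u≡v _ = ⊥-elim (Adj⇒≢ G uv (toℕ-injective u≡v))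
  ... | tri> _ _ v<u = subst (_∈ colourList) (≡.sym (symm c u v uv))
                             (∈-deduplicate⁺ _≟_ (col∈edgeColours v<u (Adj-sym G uv)))

  adj≤∑hasColour : ∀ u v → [ adj G u v ] ≤ sum (λ k → [ hasColour (colours k) u v ])
  adj≤∑hasColour u v with adj G u v in uv
  ... | false = z≤n
  ... | true  = ≤-trans (≤-reflexive (cong [_] (≡.sym (dec-true (col c u v ≟ colours k) (lookup-index colour∈)))))
                        (term≤∑ _ k)
    where
    colour∈ : col c u v ∈ colourList
    colour∈ = col∈colourList uv
    k : Fin (numColours c)
    k = index colour∈

  degSum≤∑colourClassSize : degSum G ≤ sum (colourClassSize ∘ colours)
  degSum≤∑colourClassSize = begin
    degSum G                                           ≡⟨ degSum≡∑deg G ⟩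
    sum (deg G)                                        ≡⟨ sum-cong-≗ (deg≡∑adj G) ⟩
    sum (λ u → sum λ v → [ adj G u v ])                ≤⟨ ∑-mono-≤ (λ u → ∑-mono-≤ (adj≤∑hasColour u)) ⟩
    sum (λ u → sum λ v → sum λ k → H k u v)            ≡⟨ sum-cong-≗ (λ u → ∑-comm (λ v k → H k u v)) ⟩
    sum (λ u → sum λ k → sum λ v → H k u v)            ≡⟨ ∑-comm (λ u k → sum (H k u)) ⟩
    sum (colourClassSize ∘ colours)                    ∎
    where
    open ≤-Reasoning
    H : Fin (numColours c) → Fin n → Fin n → ℕ
    H k u v = [ hasColour (colours k) u v ]

lexicographic⇒colourClassesAreStars : ∀ {n} {G : Graph n} {c : EdgeColoring G} → IsLexicographic c →
  ∀ {a b} → Adj G a b → ∃[ w ] IsStar c (col c a b) w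
lexicographic⇒colourClassesAreStars {n} {G} {c} (σ , cc , forwardColour , distinct) ab =
  let p , forward , colour≡ , _ = owner ab
  in  v p , subst (λ x → IsStar c x (v p)) (≡.sym colour≡) (starAt p forward)
  where
  v : Fin n → Fin n
  v i = σ ⟨$⟩ʳ i

  OwnedBy : Fin n → Fin n → Fin n → Set
  OwnedBy a b p = HasForwardEdge G σ p × col c a b ≡ cc p × (a ≡ v p ⊎ b ≡ v p)

  ownerAt : ∀ i j → Adj G (v i) (v j) → ∃ (OwnedBy (v i) (v j))
  ownerAt i j e with <-cmp (toℕ i) (toℕ j)
  ... | tri< i<j _ _ = i , (j , i<j , e) , forwardColour i j i<j e , inj₁ refl
  ... | tri≈ _ i≡j _ = ⊥-elim (Adj⇒≢ G e (cong v (toℕ-injective i≡j)))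
  ... | tri> _ _ j<i = j , (i , j<i , Adj-sym G e)
                         , ≡.trans (symm c _ _ e) (forwardColour j i j<i (Adj-sym G e)) , inj₂ refl

  owner : ∀ {a b} → Adj G a b → ∃ (OwnedBy a b)
  owner ab = subst₂ (λ a b → ∃ (OwnedBy a b)) (inverseʳ σ) (inverseʳ σ)
    (ownerAt _ _ (subst₂ (Adj G) (≡.sym (inverseʳ σ)) (≡.sym (inverseʳ σ)) ab))

  starAt : ∀ p → HasForwardEdge G σ p → IsStar c (cc p) (v p)
  starAt p forward e colour≡ with owner e
  ... | q , forward′ , colour≡′ , incident with q ≟ᶠ p
  ...   | yes refl = incident
  ...   | no q≢p   = ⊥-elim (distinct q p q≢p forward′ forward (≡.trans (≡.sym colour≡′) colour≡))

lemma2p6 : ∀ {n} (G : Graph n) → ∃[ u ] ∃[ v ] Adj G u v →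
    (c : EdgeColoring G) → IsLexicographic c →
    degSum G ≤ 2 * maxDeg G * numColours c
lemma2p6 G _ c lex = begin
  degSum G                                 ≤⟨ degSum≤∑colourClassSize c ⟩
  sum (colourClassSize c ∘ colours c)      ≤⟨ ∑-≤-* (colourClassSize≤2maxDeg c stars ∘ colours c) ⟩
  numColours c * (2 * maxDeg G)            ≡⟨ *-comm (numColours c) _ ⟩
  2 * maxDeg G * numColours c              ∎
  where
  open ≤-Reasoning
  stars : ∀ {a b} → Adj G a b → ∃[ w ] IsStar c (col c a b) w
  stars = lexicographic⇒colourClassesAreStars {c = c} lex
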